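{- Let $n \ge 4$. Let $M^+$ and $M^-$ be the following sets of edges of $\mathrm{P}_4$: \[ M^+ = \{2134\text{–}2314,\ 3241\text{–}2341,\ 3412\text{–}3142,\ 2413\text{–}4213,\ 4132\text{–}1432,\ 1243\text{–}1423,\ 3124\text{–}1324,\ 4321\text{–}4231\}, \] \[ M^- = \{1324\text{–}1234,\ 2143\text{–}2413,\ 4231\text{–}2431,\ 3214\text{–}2314,\ 4123\text{–}1423,\ 3142\text{–}1342,\ 4312\text{–}4132,\ 3241\text{–}3421\}. \] Let $S$ be the set of words of length $n-4$ over $[n]$ with pairwise distinct letters. For $s \in S$, let $\bar s_1<\bar s_2<\bar s_3<\bar s_4$ be the elements of $[n]$ not occurring in $s$, let $\phi_s$ send a permutation $\pi=\pi_1\pi_2\pi_3\pi_4$ of $[4]$ to the permutation $\bar s_{\pi_1}\bar s_{\pi_2}\bar s_{\pi_3}\bar s_{\pi_4}\, s$ of $[n]$ (concatenation), and let $\varepsilon(s) = (-1)^{|\mathrm{inv}(s)| + \bar s_1+\bar s_2+\bar s_3+\bar s_4}$, where $\mathrm{inv}(s)=\{(i,j)\in[n-4]^2 : i<j,\ s_i>s_j\}$. Define \[ M = \bigsqcup_{s\in S} \phi_s\big(M^{\varepsilon(s)}\big), \] where $M^{\varepsilon(s)}$ means $M^+$ if $\varepsilon(s)=1$ and $M^-$ if $\varepsilon(s)=-1$, and $\phi_s$ is applied to both endpoints of each edge. Then $M$ is a maximal matching of $\mathrm{P}_n$ of size $n!/3$.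
   Context: The permutahedron $\mathrm{P}_m$ is the graph whose vertices are the permutations of $[m]$ in one-line notation, two permutations being adjacent if one is obtained from the other by swapping the entries at two consecutive positions. In the lists above, $a\text{–}b$ denotes the edge of $\mathrm{P}_4$ between the permutations $a$ and $b$. A maximal matching is a set of pairwise vertex-disjoint edges that is maximal with respect to inclusion. -}

module Defs where

open import Data.Nat using (ℕ; zero; suc; _+_; _∸_; _<_; _≤_; _<?_)
open import Data.Nat.Properties using (_≟_)
open import Data.Nat.DivMod using (_%_)
open import Data.Bool using (Bool; true; false; if_then_else_)
open import Data.List using (List; []; _∷_; _++_; map; length; upTo; filter)
open import Data.Nat.ListAction using (sum)
open import Data.List.Membership.Propositional using (_∈_)
open import Data.List.Membership.DecPropositional _≟_ using (_∈?_)
open import Data.List.Relation.Unary.All using (All)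
open import Data.List.Relation.Unary.AllPairs using (AllPairs)
open import Data.List.Relation.Unary.Unique.Propositional using (Unique)
open import Data.List.Relation.Binary.Permutation.Propositional using (_↭_)
open import Data.Product using (Σ; ∃; _×_; _,_)
open import Data.Sum using (_⊎_)
open import Relation.Binary.PropositionalEquality using (_≡_)
open import Relation.Nullary using (¬_; ¬?)

-- Conventions: [n] = {1,…,n}; words / permutations in one-line notation are
-- lists of natural numbers.

range1 : ℕ → List ℕ
range1 n = map suc (upTo n)

IsPerm : ℕ → List ℕ → Set
IsPerm n w = w ↭ range1 n

-- swap the entries at (0-based) positions i and i+1
swapAt : ℕ → List ℕ → List ℕ
swapAt zero (x ∷ y ∷ xs) = y ∷ x ∷ xs
swapAt (suc i) (x ∷ xs) = x ∷ swapAt i xs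
swapAt _ xs = xs

AdjSwap : List ℕ → List ℕ → Set
AdjSwap u v = Σ ℕ λ i → (suc i < length u) × (v ≡ swapAt i u)

PEdge : ℕ → List ℕ → List ℕ → Set
PEdge n u v = IsPerm n u × IsPerm n v × AdjSwap u v

-- A set of edges of P_n, given as a symmetric relation E (E u v means the
-- unordered edge u–v is in the set).
-- E is a matching: all its edges are edges of P_n and they are pairwise
-- vertex-disjoint (for symmetric E: each vertex has at most one partner).
IsMatching : ℕ → (List ℕ → List ℕ → Set) → Set
IsMatching n E =
  (∀ u v → E u v → PEdge n u v) ×
  (∀ u v w → E u v → E u w → v ≡ w)

IsMaximalMatching : ℕ → (List ℕ → List ℕ → Set) → Set
IsMaximalMatching n E =
  IsMatching n E ×
  (∀ u v → PEdge n u v → (∃ λ w → E u w) ⊎ (∃ λ w → E v w))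

SameEdge : (List ℕ × List ℕ) → (List ℕ × List ℕ) → Set
SameEdge (a , b) (c , d) = (a ≡ c × b ≡ d) ⊎ (a ≡ d × b ≡ c)

EnumeratesEdges : (List ℕ → List ℕ → Set) → List (List ℕ × List ℕ) → Set
EnumeratesEdges E L =
  (∀ u v → E u v → ((u , v) ∈ L) ⊎ ((v , u) ∈ L)) ×
  (∀ u v → (u , v) ∈ L → E u v) ×
  AllPairs (λ p q → ¬ SameEdge p q) L

HasEdgeCount : (List ℕ → List ℕ → Set) → ℕ → Set
HasEdgeCount E k = Σ (List (List ℕ × List ℕ)) λ L → EnumeratesEdges E L × length L ≡ k

Mplus : List (List ℕ × List ℕ)
Mplus =
  ((2 ∷ 1 ∷ 3 ∷ 4 ∷ []) , (2 ∷ 3 ∷ 1 ∷ 4 ∷ [])) ∷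
  ((3 ∷ 2 ∷ 4 ∷ 1 ∷ []) , (2 ∷ 3 ∷ 4 ∷ 1 ∷ [])) ∷
  ((3 ∷ 4 ∷ 1 ∷ 2 ∷ []) , (3 ∷ 1 ∷ 4 ∷ 2 ∷ [])) ∷
  ((2 ∷ 4 ∷ 1 ∷ 3 ∷ []) , (4 ∷ 2 ∷ 1 ∷ 3 ∷ [])) ∷
  ((4 ∷ 1 ∷ 3 ∷ 2 ∷ []) , (1 ∷ 4 ∷ 3 ∷ 2 ∷ [])) ∷
  ((1 ∷ 2 ∷ 4 ∷ 3 ∷ []) , (1 ∷ 4 ∷ 2 ∷ 3 ∷ [])) ∷
  ((3 ∷ 1 ∷ 2 ∷ 4 ∷ []) , (1 ∷ 3 ∷ 2 ∷ 4 ∷ [])) ∷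
  ((4 ∷ 3 ∷ 2 ∷ 1 ∷ []) , (4 ∷ 2 ∷ 3 ∷ 1 ∷ [])) ∷ []

Mminus : List (List ℕ × List ℕ)
Mminus =
  ((1 ∷ 3 ∷ 2 ∷ 4 ∷ []) , (1 ∷ 2 ∷ 3 ∷ 4 ∷ [])) ∷
  ((2 ∷ 1 ∷ 4 ∷ 3 ∷ []) , (2 ∷ 4 ∷ 1 ∷ 3 ∷ [])) ∷
  ((4 ∷ 2 ∷ 3 ∷ 1 ∷ []) , (2 ∷ 4 ∷ 3 ∷ 1 ∷ [])) ∷
  ((3 ∷ 2 ∷ 1 ∷ 4 ∷ []) , (2 ∷ 3 ∷ 1 ∷ 4 ∷ [])) ∷
  ((4 ∷ 1 ∷ 2 ∷ 3 ∷ []) , (1 ∷ 4 ∷ 2 ∷ 3 ∷ [])) ∷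
  ((3 ∷ 1 ∷ 4 ∷ 2 ∷ []) , (1 ∷ 3 ∷ 4 ∷ 2 ∷ [])) ∷
  ((4 ∷ 3 ∷ 1 ∷ 2 ∷ []) , (4 ∷ 1 ∷ 3 ∷ 2 ∷ [])) ∷
  ((3 ∷ 2 ∷ 4 ∷ 1 ∷ []) , (3 ∷ 4 ∷ 2 ∷ 1 ∷ [])) ∷ []

IsWordS : ℕ → List ℕ → Set
IsWordS n s = (length s ≡ n ∸ 4) × All (λ x → 1 ≤ x × x ≤ n) s × Unique s

complement : ℕ → List ℕ → List ℕ
complement n s = filter (λ x → ¬? (x ∈? s)) (range1 n)

-- k-th entry (1-based) of a list, 0 if out of range
nth1 : List ℕ → ℕ → ℕ
nth1 [] _ = 0
nth1 (x ∷ xs) 1 = x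
nth1 (x ∷ xs) (suc (suc k)) = nth1 xs (suc k)
nth1 (x ∷ xs) zero = 0

phi : ℕ → List ℕ → List ℕ → List ℕ
phi n s π = map (nth1 (complement n s)) π ++ s

countSmaller : ℕ → List ℕ → ℕ
countSmaller x xs = length (filter (λ y → y <? x) xs)

invCount : List ℕ → ℕ
invCount [] = 0
invCount (x ∷ xs) = countSmaller x xs + invCount xs

epsilonPlus : ℕ → List ℕ → Bool
epsilonPlus n s with (invCount s + sum (complement n s)) % 2
... | zero = true
... | suc _ = false

Meps : ℕ → List ℕ → List (List ℕ × List ℕ)
Meps n s = if epsilonPlus n s then Mplus else Mminus

InM : ℕ → List ℕ → List ℕ → Set
InM n u v = Σ (List ℕ) λ s → IsWordS n s × Σ (List ℕ × List ℕ) λ ab →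
  Σ (List ℕ) λ a → Σ (List ℕ) λ b → (ab ≡ (a , b)) × (ab ∈ Meps n s) × (u ≡ phi n s a) × (v ≡ phi n s b)

Medges : ℕ → List ℕ → List ℕ → Set
Medges n u v = InM n u v ⊎ InM n v u

{-# OPTIONS --safe #-}

-- Split a vertex of Pₙ as xs ++ s with |xs| = 4.  Then s ∈ S and xs = φ_s(std xs), where std xs is
-- the pattern of xs, so M consists of copies of M^ε(s) on the fibres {φ_s(π)}; since φ_s is injective
-- and M⁺, M⁻ are matchings of P₄, M is a matching with 8·|S| = 8·n!/4! edges.
-- An edge u–v of Pₙ swaps positions i+1 and i+2.  If i < 3 it lies in a fibre, and maximality of
-- M^ε(s) in P₄ applies.  If i ≥ 4, u and v have the same pattern while the adjacent transposition of s
-- flips ε(s); since M⁺ ∪ M⁻ covers P₄, u or v is covered.  If i = 3, the quantity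
-- |inv(s)| + Σ s̄ + (rank of the first letter of s among the first five letters) is the same for u and v,
-- so whether u or v is covered depends only on the pattern of the first five letters of u, and all
-- 120 such patterns are checked by computation.

module Submission where

open import Defs
open import Data.Empty using (⊥)
open import Data.List using (List; []; _∷_; _++_; map; length; upTo; filter; concatMap)
open import Data.List.Membership.Propositional using (_∈_; _∉_; find; lose)
open import Data.List.Membership.Propositional.Properties
  using (∈-map⁺; ∈-map⁻; ∈-upTo⁺; ∈-upTo⁻; ∈-filter⁺; ∈-filter⁻; ∈-++⁺ˡ; ∈-++⁺ʳ; ∈-++⁻;
         ∈-concatMap⁺; ∈-concatMap⁻)
open import Data.List.Membership.Propositional.Properties.WithK using (unique∧set⇒bag)
open import Data.List.Properties
  using (≡-dec; map-id; map-∘; map-++; map-cong; map-cong-local; length-map; length-++; length-upTo; upTo-∷ʳ;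
         filter-++; filter-accept; filter-reject; filter-all; filter-none; filter-notAll; filter-≐;
         ∷-injectiveˡ; ∷-injectiveʳ; ++-cancelʳ)
open import Data.List.Relation.Binary.BagAndSetEquality using (∼bag⇒↭)
open import Data.List.Relation.Binary.Disjoint.Propositional using (Disjoint)
open import Data.List.Relation.Binary.Permutation.Propositional
  using (_↭_; ↭-refl; ↭-sym; ↭-trans; prep; swap; ↭⇒↭ₛ; module PermutationReasoning)
import Data.List.Relation.Binary.Permutation.Propositional.Properties as Perm
open import Data.List.Relation.Binary.Permutation.Propositional.Properties
  using (↭-length; ∈-resp-↭; filter-↭; ++⁺ʳ)
import Data.List.Relation.Binary.Permutation.Setoid.Properties as PermSetoid
open import Data.List.Relation.Unary.All as All using (All; []; _∷_)
import Data.List.Relation.Unary.All.Properties as AllP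
open import Data.List.Relation.Unary.AllPairs as AllPairs using (AllPairs; []; _∷_; allPairs?)
import Data.List.Relation.Unary.AllPairs.Properties as AllPairsP
import Data.List.Relation.Unary.Any as Any
open import Data.List.Relation.Unary.Any using (here; there)
open import Data.List.Relation.Unary.Unique.Propositional using (Unique)
import Data.List.Relation.Unary.Unique.Propositional.Properties as UniqueP
open import Data.Nat using (ℕ; zero; suc; _+_; _*_; _∸_; _≤_; _<_; z≤n; s≤s; _<?_; _/_; _!; parity)
open import Data.Nat.DivMod using (_%_; m%n<n; m≡m%n+[m/n]*n; m*n/n≡m)
open import Data.Nat.ListAction using (sum)
open import Data.Nat.ListAction.Properties using (sum-++; sum-↭)
open import Data.Nat.Properties
open import Data.Nat.Tactic.RingSolver using (solve-∀)
open import Algebra.Properties.CommutativeSemigroup +-commutativeSemigroup using (x∙yz≈y∙xz)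
open import Data.Parity.Base using (Parity; 0ℙ; 1ℙ; _⁻¹) renaming (_+_ to _ℙ+_; _*_ to _ℙ*_)
import Data.Parity.Properties as ℙ
open import Data.Product using (∃; _×_; _,_; proj₁; proj₂)
import Data.Product as Product
open import Data.Sum using (_⊎_; inj₁; inj₂; [_,_]′)
import Data.Sum as Sum
open import Function using (_∘_; flip)
open import Function.Bundles using (mk⇔)
open import Relation.Binary.Definitions using (DecidableEquality; tri<; tri≈; tri>)
open import Relation.Binary.PropositionalEquality
  using (_≡_; _≢_; refl; sym; trans; cong; cong₂; subst; subst₂; setoid; module ≡-Reasoning)
open import Relation.Nullary using (¬_; ¬?; Dec; yes; no; contradiction)
open import Relation.Nullary.Decidable using (from-yes; _×-dec_; _⊎-dec_)
open import Relation.Unary using (Decidable)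

open import Data.List.Membership.DecPropositional _≟_ using (_∈?_)

_≟ₗ_ : DecidableEquality (List ℕ)
_≟ₗ_ = ≡-dec _≟_

open import Data.List.Membership.DecPropositional _≟ₗ_ using () renaming (_∈?_ to _∈ₗ?_)
open import Data.List.Relation.Unary.Unique.DecPropositional _≟ₗ_ using (unique?)

module _ {A : Set} where

  Unique-resp-↭ : {xs ys : List A} → xs ↭ ys → Unique xs → Unique ys
  Unique-resp-↭ p = PermSetoid.Unique-resp-↭ (setoid A) (↭⇒↭ₛ p)

  unique∧same-elements⇒↭ : {xs ys : List A} → Unique xs → Unique ys →
    (∀ {x} → x ∈ xs → x ∈ ys) → (∀ {x} → x ∈ ys → x ∈ xs) → xs ↭ ys
  unique∧same-elements⇒↭ uxs uys xs⊆ys ys⊆xs = ∼bag⇒↭ (unique∧set⇒bag uxs uys (mk⇔ xs⊆ys ys⊆xs))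

  Unique-++⁻ʳ : ∀ (xs : List A) {ys} → Unique (xs ++ ys) → Unique ys
  Unique-++⁻ʳ []       u       = u
  Unique-++⁻ʳ (x ∷ xs) (_ ∷ u) = Unique-++⁻ʳ xs u

  Unique-++⁻ˡ : ∀ (xs : List A) {ys} → Unique (xs ++ ys) → Unique xs
  Unique-++⁻ˡ []       u         = []
  Unique-++⁻ˡ (x ∷ xs) (x∉ ∷ u) = All.tabulate (All.lookup x∉ ∘ ∈-++⁺ˡ) ∷ Unique-++⁻ˡ xs u

  Unique-++-disjoint : ∀ (xs : List A) {ys x} → Unique (xs ++ ys) → x ∈ xs → x ∉ ys
  Unique-++-disjoint (y ∷ xs) (y∉ ∷ u) (here refl) x∈ys = All.lookup y∉ (∈-++⁺ʳ xs x∈ys) refl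
  Unique-++-disjoint (y ∷ xs) (_ ∷ u)  (there x∈xs) = Unique-++-disjoint xs u x∈xs

  ++-cancelˡ-length : ∀ (xs ys : List A) {zs ws} → length xs ≡ length ys → xs ++ zs ≡ ys ++ ws → zs ≡ ws
  ++-cancelˡ-length []       []       _   eq = eq
  ++-cancelˡ-length (x ∷ xs) (y ∷ ys) len eq = ++-cancelˡ-length xs ys (suc-injective len) (∷-injectiveʳ eq)

  map-injectiveOn : {B : Set} {P : A → Set} {f : A → B} → (∀ {x y} → P x → P y → f x ≡ f y → x ≡ y) →
    ∀ {xs ys} → All P xs → All P ys → map f xs ≡ map f ys → xs ≡ ys
  map-injectiveOn inj []         []         _  = refl
  map-injectiveOn inj (px ∷ pxs) (py ∷ pys) eq =
    cong₂ _∷_ (inj px py (∷-injectiveˡ eq)) (map-injectiveOn inj pxs pys (∷-injectiveʳ eq))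

  AllPairs-map⁺-on : {B : Set} {P : A → Set} {R : A → A → Set} {S : B → B → Set} {f : A → B} →
    (∀ {x y} → P x → P y → R x y → S (f x) (f y)) →
    ∀ {xs} → All P xs → AllPairs R xs → AllPairs S (map f xs)
  AllPairs-map⁺-on lift []         []         = []
  AllPairs-map⁺-on lift (px ∷ pxs) (rx ∷ rxs) =
    AllP.map⁺ (All.zipWith (λ (py , r) → lift px py r) (pxs , rx)) ∷ AllPairs-map⁺-on lift pxs rxs

module _ {A : Set} {P Q : A → Set} (P? : Decidable P) (Q? : Decidable Q) (P⇒Q : ∀ {x} → P x → Q x) where

  length-filter-mono : ∀ xs → length (filter P? xs) ≤ length (filter Q? xs)
  length-filter-mono []       = z≤n
  length-filter-mono (x ∷ xs) with P? x | Q? x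
  ... | yes _  | yes _  = s≤s (length-filter-mono xs)
  ... | yes px | no ¬qx = contradiction (P⇒Q px) ¬qx
  ... | no _   | yes _  = m≤n⇒m≤1+n (length-filter-mono xs)
  ... | no _   | no _   = length-filter-mono xs

  length-filter-strictMono : ∀ {x xs} → x ∈ xs → ¬ P x → Q x → length (filter P? xs) < length (filter Q? xs)
  length-filter-strictMono {x} {_ ∷ xs} (here refl) ¬px qx with P? x | Q? x
  ... | yes px | _      = contradiction px ¬px
  ... | no _   | yes _  = s≤s (length-filter-mono xs)
  ... | no _   | no ¬qx = contradiction qx ¬qx
  length-filter-strictMono {x} {y ∷ xs} (there x∈xs) ¬px qx with P? y | Q? y
  ... | yes _  | yes _  = s≤s (length-filter-strictMono x∈xs ¬px qx)
  ... | yes py | no ¬qy = contradiction (P⇒Q py) ¬qy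
  ... | no _   | yes _  = m<n⇒m<1+n (length-filter-strictMono x∈xs ¬px qx)
  ... | no _   | no _   = length-filter-strictMono x∈xs ¬px qx

swapAt-↭ : ∀ i (xs : List ℕ) → swapAt i xs ↭ xs
swapAt-↭ zero    []           = ↭-refl
swapAt-↭ zero    (x ∷ [])     = ↭-refl
swapAt-↭ zero    (x ∷ y ∷ xs) = swap y x ↭-refl
swapAt-↭ (suc i) []           = ↭-refl
swapAt-↭ (suc i) (x ∷ xs)     = prep x (swapAt-↭ i xs)

map-swapAt : ∀ (f : ℕ → ℕ) i xs → map f (swapAt i xs) ≡ swapAt i (map f xs)
map-swapAt f zero    []           = refl
map-swapAt f zero    (x ∷ [])     = refl
map-swapAt f zero    (x ∷ y ∷ xs) = refl
map-swapAt f (suc i) []           = refl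
map-swapAt f (suc i) (x ∷ xs)     = cong (f x ∷_) (map-swapAt f i xs)

swapAt-++ : ∀ i xs (s : List ℕ) → suc i < length xs → swapAt i (xs ++ s) ≡ swapAt i xs ++ s
swapAt-++ zero    (x ∷ y ∷ xs) s _          = refl
swapAt-++ zero    (x ∷ [])     s (s≤s ())
swapAt-++ (suc i) (x ∷ xs)     s (s≤s i<xs) = cong (x ∷_) (swapAt-++ i xs s i<xs)

InRange : ℕ → ℕ → Set
InRange n x = 1 ≤ x × x ≤ n

IsInjWord : ℕ → ℕ → List ℕ → Set
IsInjWord n k s = length s ≡ k × All (InRange n) s × Unique s

length-range1 : ∀ n → length (range1 n) ≡ n
length-range1 n = trans (length-map suc (upTo n)) (length-upTo n)

∈-range1⁺ : ∀ {n x} → InRange n x → x ∈ range1 n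
∈-range1⁺ {x = suc x} (_ , x<n) = ∈-map⁺ suc (∈-upTo⁺ x<n)

∈-range1⁻ : ∀ {n x} → x ∈ range1 n → InRange n x
∈-range1⁻ x∈ with ∈-map⁻ suc x∈
... | _ , y∈ , refl = s≤s z≤n , ∈-upTo⁻ y∈

range1-suc : ∀ n → range1 (suc n) ≡ range1 n ++ suc n ∷ []
range1-suc n = trans (cong (map suc) (sym (upTo-∷ʳ n))) (map-++ suc (upTo n) (n ∷ []))

range1-unique : ∀ n → Unique (range1 n)
range1-unique n = UniqueP.map⁺ suc-injective (UniqueP.upTo⁺ n)

range1-sorted : ∀ n → AllPairs _<_ (range1 n)
range1-sorted n = AllPairsP.map⁺ (AllPairsP.applyUpTo⁺₁ (λ x → x) n (λ i<j _ → s≤s i<j))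

length-perm : ∀ {n u} → IsPerm n u → length u ≡ n
length-perm {n} p = trans (↭-length p) (length-range1 n)

perm-unique : ∀ {n u} → IsPerm n u → Unique u
perm-unique {n} p = Unique-resp-↭ (↭-sym p) (range1-unique n)

perm-inRange : ∀ {n u} → IsPerm n u → All (InRange n) u
perm-inRange p = All.tabulate (∈-range1⁻ ∘ ∈-resp-↭ p)

module _ {n : ℕ} {s : List ℕ} where

  ∈-complement⁺ : ∀ {x} → InRange n x → x ∉ s → x ∈ complement n s
  ∈-complement⁺ x∈[n] x∉s = ∈-filter⁺ (λ x → ¬? (x ∈? s)) (∈-range1⁺ x∈[n]) x∉s

  ∈-complement⁻ : ∀ {x} → x ∈ complement n s → InRange n x × x ∉ s
  ∈-complement⁻ x∈ with ∈-filter⁻ (λ x → ¬? (x ∈? s)) x∈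
  ... | x∈[n] , x∉s = ∈-range1⁻ x∈[n] , x∉s

  complement-unique : Unique (complement n s)
  complement-unique = UniqueP.filter⁺ (λ x → ¬? (x ∈? s)) (range1-unique n)

  complement-sorted : AllPairs _<_ (complement n s)
  complement-sorted = AllPairsP.filter⁺ (λ x → ¬? (x ∈? s)) (range1-sorted n)

  complement-++-↭ : All (InRange n) s → Unique s → complement n s ++ s ↭ range1 n
  complement-++-↭ s⊆[n] us = unique∧same-elements⇒↭
    (UniqueP.++⁺ complement-unique us (λ (x∈c , x∈s) → proj₂ (∈-complement⁻ x∈c) x∈s))
    (range1-unique n) ⊆[n] [n]⊆
    where
    ⊆[n] : ∀ {x} → x ∈ complement n s ++ s → x ∈ range1 n
    ⊆[n] x∈ with ∈-++⁻ (complement n s) x∈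
    ... | inj₁ x∈c = ∈-range1⁺ (proj₁ (∈-complement⁻ x∈c))
    ... | inj₂ x∈s = ∈-range1⁺ (All.lookup s⊆[n] x∈s)
    [n]⊆ : ∀ {x} → x ∈ range1 n → x ∈ complement n s ++ s
    [n]⊆ {x} x∈[n] with x ∈? s
    ... | yes x∈s = ∈-++⁺ʳ (complement n s) x∈s
    ... | no x∉s  = ∈-++⁺ˡ (∈-complement⁺ (∈-range1⁻ x∈[n]) x∉s)

  length-complement : All (InRange n) s → Unique s → length (complement n s) + length s ≡ n
  length-complement s⊆[n] us = begin
    length (complement n s) + length s ≡⟨ length-++ (complement n s) ⟨
    length (complement n s ++ s)       ≡⟨ length-perm (complement-++-↭ s⊆[n] us) ⟩
    n                                  ∎
    where open ≡-Reasoning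

  sum-complement : All (InRange n) s → Unique s → sum (complement n s) + sum s ≡ sum (range1 n)
  sum-complement s⊆[n] us = trans (sym (sum-++ (complement n s) s)) (sum-↭ (complement-++-↭ s⊆[n] us))

complement-cong : ∀ n {s t} → (∀ {x} → x ∈ s → x ∈ t) → (∀ {x} → x ∈ t → x ∈ s) →
  complement n s ≡ complement n t
complement-cong n {s} {t} s⊆t t⊆s = filter-≐ (λ x → ¬? (x ∈? s)) (λ x → ¬? (x ∈? t))
  ((λ x∉s → x∉s ∘ t⊆s) , (λ x∉t → x∉t ∘ s⊆t)) (range1 n)

injWord⇒perm : ∀ {n s} → IsInjWord n n s → IsPerm n s
injWord⇒perm {n} {s} (len , s⊆[n] , us) =
  subst (λ c → c ++ s ↭ range1 n) complement≡[] (complement-++-↭ s⊆[n] us)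
  where
  complement≡[] : complement n s ≡ []
  complement≡[] with complement n s | length-complement s⊆[n] us
  ... | []    | _  = refl
  ... | _ ∷ c | eq = contradiction (trans eq (sym len)) (m≢1+n+m (length s) ∘ sym)

-- Ranks and standardisation

countSmaller-++ : ∀ x xs ys → countSmaller x (xs ++ ys) ≡ countSmaller x xs + countSmaller x ys
countSmaller-++ x xs ys = trans (cong length (filter-++ (_<? x) xs ys)) (length-++ (filter (_<? x) xs))

countSmaller-↭ : ∀ x {xs ys} → xs ↭ ys → countSmaller x xs ≡ countSmaller x ys
countSmaller-↭ x p = ↭-length (filter-↭ (_<? x) p)

countSmaller-accept : ∀ {x y} ys → y < x → countSmaller x (y ∷ ys) ≡ suc (countSmaller x ys)
countSmaller-accept {x} _ y<x = cong length (filter-accept (_<? x) y<x)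

countSmaller-reject : ∀ {x y} ys → ¬ y < x → countSmaller x (y ∷ ys) ≡ countSmaller x ys
countSmaller-reject {x} _ y≮x = cong length (filter-reject (_<? x) y≮x)

countSmaller-strictMono : ∀ {x y zs} → x ∈ zs → x < y → countSmaller x zs < countSmaller y zs
countSmaller-strictMono {x} x∈zs x<y =
  length-filter-strictMono (_<? _) (_<? _) (λ z<x → <-trans z<x x<y) x∈zs (<-irrefl refl) x<y

countSmaller-range1 : ∀ n {x} → x ≤ suc n → countSmaller x (range1 n) ≡ x ∸ 1
countSmaller-range1 zero {zero}  _ = refl
countSmaller-range1 zero {suc x} (s≤s x≤0) rewrite n≤0⇒n≡0 x≤0 = refl
countSmaller-range1 (suc n) {x} x≤2+n with suc n <? x
... | no 1+n≮x = begin
  countSmaller x (range1 (suc n))                       ≡⟨ cong (countSmaller x) (range1-suc n) ⟩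
  countSmaller x (range1 n ++ suc n ∷ [])               ≡⟨ countSmaller-++ x (range1 n) (suc n ∷ []) ⟩
  countSmaller x (range1 n) + countSmaller x (suc n ∷ []) ≡⟨ cong₂ _+_ (countSmaller-range1 n (≮⇒≥ 1+n≮x))
                                                                        (countSmaller-reject [] 1+n≮x) ⟩
  x ∸ 1 + 0                                             ≡⟨ +-identityʳ _ ⟩
  x ∸ 1                                                 ∎
  where open ≡-Reasoning
... | yes 1+n<x with ≤-antisym x≤2+n 1+n<x
... | refl = begin
  countSmaller (suc (suc n)) (range1 (suc n))          ≡⟨ cong length (filter-all (_<? suc (suc n)) all<) ⟩
  length (range1 (suc n))                               ≡⟨ length-range1 (suc n) ⟩
  suc n                                                 ∎
  where
  open ≡-Reasoning
  all< : All (_< suc (suc n)) (range1 (suc n))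
  all< = All.tabulate (s≤s ∘ proj₂ ∘ ∈-range1⁻)

countSmaller-none : ∀ {x ys} → All (λ y → ¬ y < x) ys → countSmaller x ys ≡ 0
countSmaller-none {x} ys≮x = cong length (filter-none (_<? x) ys≮x)

rank : List ℕ → ℕ → ℕ
rank xs x = suc (countSmaller x xs)

standardise : List ℕ → List ℕ
standardise xs = map (rank xs) xs

rank-↭ : ∀ {xs ys} x → xs ↭ ys → rank xs x ≡ rank ys x
rank-↭ x p = cong suc (countSmaller-↭ x p)

rank-strictMono : ∀ {xs x y} → x ∈ xs → x < y → rank xs x < rank xs y
rank-strictMono x∈xs x<y = s≤s (countSmaller-strictMono x∈xs x<y)

rank-injective : ∀ {xs x y} → x ∈ xs → y ∈ xs → rank xs x ≡ rank xs y → x ≡ y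
rank-injective {x = x} {y} x∈xs y∈xs eq with <-cmp x y
... | tri< x<y _ _ = contradiction eq (<⇒≢ (rank-strictMono x∈xs x<y))
... | tri≈ _ x≡y _ = x≡y
... | tri> _ _ y<x = contradiction (sym eq) (<⇒≢ (rank-strictMono y∈xs y<x))

rank-inRange : ∀ {xs x} → x ∈ xs → InRange (length xs) (rank xs x)
rank-inRange {xs} {x} x∈xs = s≤s z≤n , filter-notAll (_<? x) xs (Any.map (λ { refl → <-irrefl refl }) x∈xs)

nth1-rank : ∀ {c x} → AllPairs _<_ c → x ∈ c → nth1 c (rank c x) ≡ x
nth1-rank {y ∷ c} {x} (x< ∷ _) (here refl)
  rewrite countSmaller-reject {x} c (<-irrefl refl)
        | countSmaller-none {x} (All.map <⇒≯ x<) = refl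
nth1-rank {y ∷ c} {x} (y< ∷ sorted) (there x∈c)
  rewrite countSmaller-accept {x} c (All.lookup y< x∈c) = nth1-rank sorted x∈c

nth1-∈ : ∀ {c k} → InRange (length c) k → nth1 c k ∈ c
nth1-∈ {[]}    {zero}        (() , _)
nth1-∈ {[]}    {suc _}       (_ , ())
nth1-∈ {_ ∷ _} {zero}        (() , _)
nth1-∈ {_ ∷ _} {1}           _ = here refl
nth1-∈ {_ ∷ c} {suc (suc k)} (_ , s≤s k<) = there (nth1-∈ (s≤s z≤n , k<))

nth1-injective : ∀ {c i j} → Unique c → InRange (length c) i → InRange (length c) j →
  nth1 c i ≡ nth1 c j → i ≡ j
nth1-injective {[]}    {zero}  _ (() , _)
nth1-injective {[]}    {suc _} _ (_ , ())
nth1-injective {_ ∷ _} {zero}  _ (() , _)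
nth1-injective {_ ∷ _} {suc _} {zero} _ _ (() , _)
nth1-injective {_ ∷ _} {1} {1} _ _ _ _ = refl
nth1-injective {_ ∷ c} {1} {suc (suc j)} (x∉c ∷ _) _ (_ , s≤s j<) eq =
  contradiction eq (All.lookup x∉c (nth1-∈ (s≤s z≤n , j<)))
nth1-injective {_ ∷ c} {suc (suc i)} {1} (x∉c ∷ _) (_ , s≤s i<) _ eq =
  contradiction (sym eq) (All.lookup x∉c (nth1-∈ (s≤s z≤n , i<)))
nth1-injective {_ ∷ c} {suc (suc i)} {suc (suc j)} (_ ∷ uc) (_ , s≤s i<) (_ , s≤s j<) eq =
  cong suc (nth1-injective uc (s≤s z≤n , i<) (s≤s z≤n , j<) eq)

standardise-unique : ∀ {xs} → Unique xs → Unique (standardise xs)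
standardise-unique {xs} uxs =
  AllPairs-map⁺-on (λ x∈ y∈ x≢y → x≢y ∘ rank-injective x∈ y∈) (All.tabulate (λ x∈ → x∈)) uxs

standardise-inRange : ∀ xs → All (InRange (length xs)) (standardise xs)
standardise-inRange xs = AllP.map⁺ (All.tabulate rank-inRange)

standardise-swapAt : ∀ i xs → standardise (swapAt i xs) ≡ swapAt i (standardise xs)
standardise-swapAt i xs = begin
  map (rank (swapAt i xs)) (swapAt i xs) ≡⟨ map-cong (λ x → rank-↭ x (swapAt-↭ i xs)) (swapAt i xs) ⟩
  map (rank xs) (swapAt i xs)            ≡⟨ map-swapAt (rank xs) i xs ⟩
  swapAt i (map (rank xs) xs)            ∎
  where open ≡-Reasoning

module _ {f : ℕ → ℕ} {xs : List ℕ} (f-mono : ∀ {a b} → a ∈ xs → b ∈ xs → a < b → f a < f b) where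

  private
    f-reflects-< : ∀ {a b} → a ∈ xs → b ∈ xs → f a < f b → a < b
    f-reflects-< {a} {b} a∈ b∈ fa<fb with <-cmp a b
    ... | tri< a<b _ _ = a<b
    ... | tri≈ _ refl _ = contradiction fa<fb (<-irrefl refl)
    ... | tri> _ _ b<a = contradiction fa<fb (<⇒≯ (f-mono b∈ a∈ b<a))

    countSmaller-map : ∀ {z zs} → z ∈ xs → All (_∈ xs) zs → countSmaller (f z) (map f zs) ≡ countSmaller z zs
    countSmaller-map {z} {[]}     _   _            = refl
    countSmaller-map {z} {w ∷ zs} z∈ (w∈ ∷ zs⊆xs) with w <? z
    ... | yes w<z = begin
      countSmaller (f z) (f w ∷ map f zs) ≡⟨ countSmaller-accept (map f zs) (f-mono w∈ z∈ w<z) ⟩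
      suc (countSmaller (f z) (map f zs)) ≡⟨ cong suc (countSmaller-map z∈ zs⊆xs) ⟩
      suc (countSmaller z zs)             ≡⟨ countSmaller-accept zs w<z ⟨
      countSmaller z (w ∷ zs)             ∎
      where open ≡-Reasoning
    ... | no w≮z = begin
      countSmaller (f z) (f w ∷ map f zs) ≡⟨ countSmaller-reject (map f zs) (w≮z ∘ f-reflects-< w∈ z∈) ⟩
      countSmaller (f z) (map f zs)       ≡⟨ countSmaller-map z∈ zs⊆xs ⟩
      countSmaller z zs                   ≡⟨ countSmaller-reject zs w≮z ⟨
      countSmaller z (w ∷ zs)             ∎
      where open ≡-Reasoning

  standardise-map : ∀ {zs} → All (_∈ xs) zs → standardise (map f zs) ≡ standardise zs
  standardise-map {zs} zs⊆xs = begin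
    map (rank (map f zs)) (map f zs) ≡⟨ map-∘ zs ⟨
    map (rank (map f zs) ∘ f) zs     ≡⟨ map-cong-local (All.map (cong suc ∘ flip countSmaller-map zs⊆xs) zs⊆xs) ⟩
    map (rank zs) zs                 ∎
    where open ≡-Reasoning

length-complement-injWord : ∀ {n k s} → IsInjWord n k s → length (complement n s) ≡ n ∸ k
length-complement-injWord {n} {k} {s} (len , s⊆[n] , us) = begin
  length (complement n s)         ≡⟨ m+n∸n≡m _ k ⟨
  length (complement n s) + k ∸ k ≡⟨ cong (λ m → length (complement n s) + m ∸ k) len ⟨
  length (complement n s) + length s ∸ k ≡⟨ cong (_∸ k) (length-complement s⊆[n] us) ⟩
  n ∸ k                           ∎
  where open ≡-Reasoning

length-complement-word : ∀ {n s} → 4 ≤ n → IsWordS n s → length (complement n s) ≡ 4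
length-complement-word 4≤n w = trans (length-complement-injWord w) (m∸[m∸n]≡n 4≤n)

map-nth1-range1 : ∀ c → length c ≡ 4 → map (nth1 c) (range1 4) ≡ c
map-nth1-range1 (_ ∷ _ ∷ _ ∷ _ ∷ []) refl = refl

phi-isPerm : ∀ {n s π} → 4 ≤ n → IsWordS n s → IsPerm 4 π → IsPerm n (phi n s π)
phi-isPerm {n} {s} {π} 4≤n w@(_ , s⊆[n] , us) π↭ = begin
  map (nth1 (complement n s)) π ++ s          ↭⟨ ++⁺ʳ s (Perm.map⁺ (nth1 (complement n s)) π↭) ⟩
  map (nth1 (complement n s)) (range1 4) ++ s ≡⟨ cong (_++ s) (map-nth1-range1 _ (length-complement-word 4≤n w)) ⟩
  complement n s ++ s                         ↭⟨ complement-++-↭ s⊆[n] us ⟩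
  range1 n                                    ∎
  where open PermutationReasoning

phi-swapAt : ∀ n s {π} i → suc i < length π → swapAt i (phi n s π) ≡ phi n s (swapAt i π)
phi-swapAt n s {π} i i<π = begin
  swapAt i (map g π ++ s) ≡⟨ swapAt-++ i (map g π) s (subst (suc i <_) (sym (length-map g π)) i<π) ⟩
  swapAt i (map g π) ++ s ≡⟨ cong (_++ s) (map-swapAt g i π) ⟨
  map g (swapAt i π) ++ s ∎
  where
  open ≡-Reasoning
  g : ℕ → ℕ
  g = nth1 (complement n s)

phi-suffix : ∀ n {s t π ρ} → length π ≡ length ρ → phi n s π ≡ phi n t ρ → s ≡ t
phi-suffix n {s} {t} {π} {ρ} len = ++-cancelˡ-length (map _ π) (map _ ρ)
  (trans (length-map _ π) (trans len (sym (length-map _ ρ))))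

phi-injective : ∀ {n s π ρ} → 4 ≤ n → IsWordS n s → All (InRange 4) π → All (InRange 4) ρ →
  phi n s π ≡ phi n s ρ → π ≡ ρ
phi-injective {n} {s} {π} {ρ} 4≤n w π⊆[4] ρ⊆[4] eq =
  map-injectiveOn (nth1-injective (complement-unique {n} {s})) (inRangeC π⊆[4]) (inRangeC ρ⊆[4]) (++-cancelʳ s _ _ eq)
  where
  inRangeC : ∀ {σ} → All (InRange 4) σ → All (InRange (length (complement n s))) σ
  inRangeC = subst (λ k → All (InRange k) _) (sym (length-complement-word 4≤n w))

perm-split : ∀ {n} xs {s} → length xs ≡ 4 → IsPerm n (xs ++ s) → IsWordS n s × xs ↭ complement n s
perm-split {n} xs {s} len p = (length-s , s⊆[n] , us) , xs↭c
  where
  u : Unique (xs ++ s)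
  u = perm-unique p
  us : Unique s
  us = Unique-++⁻ʳ xs u
  s⊆[n] : All (InRange n) s
  s⊆[n] = AllP.++⁻ʳ xs (perm-inRange p)
  length-s : length s ≡ n ∸ 4
  length-s = begin
    length s                  ≡⟨ m+n∸m≡n 4 (length s) ⟨
    4 + length s ∸ 4          ≡⟨ cong (λ k → k + length s ∸ 4) len ⟨
    length xs + length s ∸ 4  ≡⟨ cong (_∸ 4) (trans (sym (length-++ xs)) (length-perm p)) ⟩
    n ∸ 4                     ∎
    where open ≡-Reasoning
  xs↭c : xs ↭ complement n s
  xs↭c = unique∧same-elements⇒↭ (Unique-++⁻ˡ xs u) (complement-unique {n} {s})
    (λ x∈xs → ∈-complement⁺ (∈-range1⁻ (∈-resp-↭ p (∈-++⁺ˡ x∈xs))) (Unique-++-disjoint xs u x∈xs))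
    (λ x∈c → let (x∈[n] , x∉s) = ∈-complement⁻ x∈c in
      [ (λ x∈xs → x∈xs) , (λ x∈s → contradiction x∈s x∉s) ]′
        (∈-++⁻ xs (∈-resp-↭ (↭-sym p) (∈-range1⁺ x∈[n]))))

phi-standardise : ∀ {n} xs {s} → length xs ≡ 4 → IsPerm n (xs ++ s) → phi n s (standardise xs) ≡ xs ++ s
phi-standardise {n} xs {s} len p = cong (_++ s) (begin
  map (nth1 c) (map (rank xs) xs) ≡⟨ map-∘ xs ⟨
  map (nth1 c ∘ rank xs) xs       ≡⟨ map-cong-local (All.tabulate nth1-rank-xs) ⟩
  map (λ x → x) xs                ≡⟨ map-id xs ⟩
  xs                              ∎)
  where
  open ≡-Reasoning
  c : List ℕ
  c = complement n s
  xs↭c : xs ↭ c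
  xs↭c = proj₂ (perm-split xs len p)
  nth1-rank-xs : ∀ {x} → x ∈ xs → nth1 c (rank xs x) ≡ x
  nth1-rank-xs {x} x∈xs =
    trans (cong (nth1 c) (rank-↭ x xs↭c)) (nth1-rank (complement-sorted {n} {s}) (∈-resp-↭ xs↭c x∈xs))

-- The sign ε(s)

weight : ℕ → List ℕ → ℕ
weight n s = invCount s + sum (complement n s)

sign : ℕ → List ℕ → Parity
sign n s = parity (weight n s)

M± : Parity → List (List ℕ × List ℕ)
M± 0ℙ = Mplus
M± 1ℙ = Mminus

parity-%2 : ∀ m → parity m ≡ parity (m % 2)
parity-%2 m = begin
  parity m                                     ≡⟨ cong parity (m≡m%n+[m/n]*n m 2) ⟩
  parity (m % 2 + m / 2 * 2)                   ≡⟨ ℙ.+-homo-+ (m % 2) (m / 2 * 2) ⟩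
  parity (m % 2) ℙ+ parity (m / 2 * 2)         ≡⟨ cong (parity (m % 2) ℙ+_) (ℙ.*-homo-* (m / 2) 2) ⟩
  parity (m % 2) ℙ+ (parity (m / 2) ℙ* 0ℙ)     ≡⟨ cong (parity (m % 2) ℙ+_) (ℙ.*-zeroʳ (parity (m / 2))) ⟩
  parity (m % 2) ℙ+ 0ℙ                         ≡⟨ ℙ.+-identityʳ (parity (m % 2)) ⟩
  parity (m % 2)                               ∎
  where open ≡-Reasoning

Meps≡M±-sign : ∀ n s → Meps n s ≡ M± (sign n s)
Meps≡M±-sign n s with (invCount s + sum (complement n s)) % 2
                   | m%n<n (invCount s + sum (complement n s)) 2
                   | parity-%2 (invCount s + sum (complement n s))
... | 0           | _            | p≡0ℙ = cong M± (sym p≡0ℙ)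
... | 1           | _            | p≡1ℙ = cong M± (sym p≡1ℙ)
... | suc (suc _) | s≤s (s≤s ()) | _

parity-suc : ∀ m → parity (suc m) ≡ parity m ⁻¹
parity-suc m = sym (ℙ.⁻¹-selfInverse (ℙ.suc-homo-⁻¹ m))

invCount-swap₀ : ∀ {a b} t → a < b → invCount (b ∷ a ∷ t) ≡ suc (invCount (a ∷ b ∷ t))
invCount-swap₀ {a} {b} t a<b = begin
  countSmaller b (a ∷ t) + (countSmaller a t + invCount t)
    ≡⟨ cong (_+ _) (countSmaller-accept t a<b) ⟩
  suc (countSmaller b t + (countSmaller a t + invCount t))
    ≡⟨ cong suc (x∙yz≈y∙xz (countSmaller b t) (countSmaller a t) (invCount t)) ⟩
  suc (countSmaller a t + (countSmaller b t + invCount t))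
    ≡⟨ cong (λ k → suc (k + _)) (countSmaller-reject t (<⇒≯ a<b)) ⟨
  suc (countSmaller a (b ∷ t) + (countSmaller b t + invCount t)) ∎
  where open ≡-Reasoning

invCount-swapAt : ∀ j {s} → Unique s → suc j < length s →
  invCount (swapAt j s) ≡ suc (invCount s) ⊎ invCount s ≡ suc (invCount (swapAt j s))
invCount-swapAt zero {a ∷ b ∷ t} ((a≢b ∷ _) ∷ _) _ with <-cmp a b
... | tri< a<b _ _ = inj₁ (invCount-swap₀ t a<b)
... | tri≈ _ a≡b _ = contradiction a≡b a≢b
... | tri> _ _ b<a = inj₂ (invCount-swap₀ t b<a)
invCount-swapAt zero {_ ∷ []} _ (s≤s ())
invCount-swapAt (suc j) {a ∷ t} (_ ∷ ut) (s≤s j<t)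
  rewrite countSmaller-↭ a (swapAt-↭ j t) with invCount-swapAt j ut j<t
... | inj₁ eq = inj₁ (trans (cong (countSmaller a t +_) eq) (+-suc _ _))
... | inj₂ eq = inj₂ (trans (cong (countSmaller a t +_) eq) (+-suc _ _))

complement-swapAt : ∀ n j s → complement n (swapAt j s) ≡ complement n s
complement-swapAt n j s = complement-cong n (∈-resp-↭ (swapAt-↭ j s)) (∈-resp-↭ (↭-sym (swapAt-↭ j s)))

sign-swapAt : ∀ n j {s} → Unique s → suc j < length s → sign n (swapAt j s) ≡ sign n s ⁻¹
sign-swapAt n j {s} us j<s with invCount-swapAt j us j<s | complement-swapAt n j s
... | inj₁ eq | c≡ = trans (cong parity (cong₂ _+_ eq (cong sum c≡))) (parity-suc (weight n s))
... | inj₂ eq | c≡ = sym (ℙ.⁻¹-selfInverse (trans (sym (parity-suc (weight n (swapAt j s))))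
                                                   (cong parity (cong₂ _+_ (sym eq) (cong sum c≡)))))

countSmaller-+-rank : ∀ {n} X {r y} → IsPerm n (X ++ r) → y ∈ X → countSmaller y r + rank X y ≡ y
countSmaller-+-rank {n} X {r} {y} p y∈X with All.lookup (perm-inRange p) (∈-++⁺ˡ y∈X)
... | s≤s z≤n , y≤n = begin
  countSmaller y r + suc (countSmaller y X)  ≡⟨ +-suc (countSmaller y r) (countSmaller y X) ⟩
  suc (countSmaller y r + countSmaller y X)  ≡⟨ cong suc (+-comm (countSmaller y r) (countSmaller y X)) ⟩
  suc (countSmaller y X + countSmaller y r)  ≡⟨ cong suc (countSmaller-++ y X r) ⟨
  suc (countSmaller y (X ++ r))              ≡⟨ cong suc (countSmaller-↭ y p) ⟩
  suc (countSmaller y (range1 n))            ≡⟨ cong suc (countSmaller-range1 n (m≤n⇒m≤1+n y≤n)) ⟩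
  y                                          ∎
  where open ≡-Reasoning

-- The right-hand side does not depend on y.
weight-+-rank : ∀ {n} X {r y} → IsPerm n (X ++ r) → y ∈ X → All (InRange n) (y ∷ r) → Unique (y ∷ r) →
  weight n (y ∷ r) + rank X y + sum r ≡ invCount r + sum (range1 n)
weight-+-rank {n} X {r} {y} p y∈X yr⊆[n] uyr = begin
  (countSmaller y r + invCount r + sum c) + rank X y + sum r
    ≡⟨ rearrange (countSmaller y r) (invCount r) (sum c) (rank X y) (sum r) ⟩
  invCount r + (sum c + ((countSmaller y r + rank X y) + sum r))
    ≡⟨ cong (λ k → invCount r + (sum c + (k + sum r))) (countSmaller-+-rank X p y∈X) ⟩
  invCount r + (sum c + (y + sum r))
    ≡⟨ cong (invCount r +_) (sum-complement yr⊆[n] uyr) ⟩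
  invCount r + sum (range1 n) ∎
  where
  open ≡-Reasoning
  c : List ℕ
  c = complement n (y ∷ r)
  rearrange : ∀ a b d e f → (a + b + d) + e + f ≡ b + (d + ((a + e) + f))
  rearrange = solve-∀

sign-boundary : ∀ {n} X {r x y} → IsPerm n (X ++ r) → x ∈ X → y ∈ X →
  All (InRange n) (x ∷ r) → Unique (x ∷ r) → All (InRange n) (y ∷ r) → Unique (y ∷ r) →
  sign n (x ∷ r) ≡ sign n (y ∷ r) ℙ+ parity (rank X y) ℙ+ parity (rank X x)
sign-boundary {n} X {r} {x} {y} p x∈X y∈X xr⊆[n] uxr yr⊆[n] uyr =
  move (sign n (x ∷ r)) (sign n (y ∷ r)) (parity (rank X x)) (parity (rank X y)) (begin
  sign n (x ∷ r) ℙ+ parity (rank X x)  ≡⟨ ℙ.+-homo-+ (weight n (x ∷ r)) (rank X x) ⟨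
  parity (weight n (x ∷ r) + rank X x) ≡⟨ cong parity (+-cancelʳ-≡ (sum r) _ _ same-total) ⟩
  parity (weight n (y ∷ r) + rank X y) ≡⟨ ℙ.+-homo-+ (weight n (y ∷ r)) (rank X y) ⟩
  sign n (y ∷ r) ℙ+ parity (rank X y)  ∎)
  where
  open ≡-Reasoning
  same-total : weight n (x ∷ r) + rank X x + sum r ≡ weight n (y ∷ r) + rank X y + sum r
  same-total = trans (weight-+-rank X p x∈X xr⊆[n] uxr) (sym (weight-+-rank X p y∈X yr⊆[n] uyr))
  move : ∀ a b c d → a ℙ+ c ≡ b ℙ+ d → a ≡ b ℙ+ d ℙ+ c
  move a b c d eq = begin
    a                ≡⟨ ℙ.+-identityʳ a ⟨
    a ℙ+ 0ℙ          ≡⟨ cong (a ℙ+_) (ℙ.p+p≡0ℙ c) ⟨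
    a ℙ+ (c ℙ+ c)    ≡⟨ ℙ.+-assoc a c c ⟨
    a ℙ+ c ℙ+ c      ≡⟨ cong (_ℙ+ c) eq ⟩
    b ℙ+ d ℙ+ c      ∎

oriented : {A : Set} → List (A × A) → List (A × A)
oriented []             = []
oriented ((a , b) ∷ es) = (a , b) ∷ (b , a) ∷ oriented es

module _ {A : Set} where

  ∈-oriented⁺ : ∀ {es : List (A × A)} {a b} → (a , b) ∈ es ⊎ (b , a) ∈ es → (a , b) ∈ oriented es
  ∈-oriented⁺ {_ ∷ _} (inj₁ (here refl))  = here refl
  ∈-oriented⁺ {_ ∷ _} (inj₂ (here refl))  = there (here refl)
  ∈-oriented⁺ {_ ∷ _} (inj₁ (there ab∈)) = there (there (∈-oriented⁺ (inj₁ ab∈)))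
  ∈-oriented⁺ {_ ∷ _} (inj₂ (there ba∈)) = there (there (∈-oriented⁺ (inj₂ ba∈)))

  ∈-oriented⁻ : ∀ {es : List (A × A)} {a b} → (a , b) ∈ oriented es → (a , b) ∈ es ⊎ (b , a) ∈ es
  ∈-oriented⁻ {_ ∷ _} (here refl)         = inj₁ (here refl)
  ∈-oriented⁻ {_ ∷ _} (there (here refl)) = inj₂ (here refl)
  ∈-oriented⁻ {_ ∷ _} (there (there ab∈)) = [ inj₁ ∘ there , inj₂ ∘ there ]′ (∈-oriented⁻ ab∈)

  Unique-proj₁⇒functional : ∀ {ps : List (A × A)} {a b c} → Unique (map proj₁ ps) →
    (a , b) ∈ ps → (a , c) ∈ ps → b ≡ c
  Unique-proj₁⇒functional _         (here refl) (here refl) = refl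
  Unique-proj₁⇒functional (a∉ ∷ _)  (here refl) (there ac∈) = contradiction refl (All.lookup a∉ (∈-map⁺ proj₁ ac∈))
  Unique-proj₁⇒functional (a∉ ∷ _)  (there ab∈) (here refl) = contradiction refl (All.lookup a∉ (∈-map⁺ proj₁ ab∈))
  Unique-proj₁⇒functional (_ ∷ ups) (there ab∈) (there ac∈) = Unique-proj₁⇒functional ups ab∈ ac∈

Touches : List (List ℕ × List ℕ) → List ℕ → Set
Touches es π = π ∈ map proj₁ (oriented es)

touches? : ∀ es π → Dec (Touches es π)
touches? es π = π ∈ₗ? map proj₁ (oriented es)

touches⇒partner : ∀ {es π} → Touches es π → ∃ λ ρ → (π , ρ) ∈ oriented es
touches⇒partner t with ∈-map⁻ proj₁ t
... | (_ , ρ) , e∈ , refl = ρ , e∈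

arrangements : ℕ → ℕ → List (List ℕ)
arrangements n zero    = [] ∷ []
arrangements n (suc k) = concatMap (λ w → map (_∷ w) (complement n w)) (arrangements n k)

arrangements-sound : ∀ {n} k {w} → w ∈ arrangements n k → IsInjWord n k w
arrangements-sound zero (here refl) = refl , [] , []
arrangements-sound {n} (suc k) w∈
  with find (∈-concatMap⁻ (λ w → map (_∷ w) (complement n w)) {xs = arrangements n k} w∈)
... | v , v∈ , xv∈ with ∈-map⁻ (_∷ v) xv∈
... | x , x∈c , refl with arrangements-sound k v∈ | ∈-complement⁻ {n} {v} x∈c
... | len , v⊆[n] , uv | x∈[n] , x∉v =
  cong suc len , x∈[n] ∷ v⊆[n] , All.tabulate (λ { y∈v refl → x∉v y∈v }) ∷ uv

arrangements-complete : ∀ {n k w} → IsInjWord n k w → w ∈ arrangements n k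
arrangements-complete {w = []}    (refl , _ , _) = here refl
arrangements-complete {n} {w = x ∷ v} (refl , x∈[n] ∷ v⊆[n] , x∉v ∷ uv) =
  ∈-concatMap⁺ (λ w → map (_∷ w) (complement n w))
    (lose (arrangements-complete (refl , v⊆[n] , uv))
          (∈-map⁺ (_∷ v) (∈-complement⁺ x∈[n] (λ x∈v → All.lookup x∉v x∈v refl))))

arrangements-unique : ∀ n k → Unique (arrangements n k)
arrangements-unique n zero    = [] ∷ []
arrangements-unique n (suc k) = UniqueP.concat⁺
  (AllP.map⁺ (All.tabulate (λ {w} _ → UniqueP.map⁺ ∷-injectiveˡ (complement-unique {n} {w}))))
  (AllPairsP.map⁺ (AllPairs.map disjoint (arrangements-unique n k)))
  where
  disjoint : ∀ {v w} → v ≢ w → Disjoint (map (_∷ v) (complement n v)) (map (_∷ w) (complement n w))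
  disjoint v≢w (xv∈ , yw∈) with ∈-map⁻ (_∷ _) xv∈ | ∈-map⁻ (_∷ _) yw∈
  ... | _ , _ , refl | _ , _ , eq = v≢w (∷-injectiveʳ eq)

length-concatMap-const : {A B : Set} (f : A → List B) {m : ℕ} →
  ∀ xs → (∀ {x} → x ∈ xs → length (f x) ≡ m) → length (concatMap f xs) ≡ length xs * m
length-concatMap-const f []       _   = refl
length-concatMap-const f (x ∷ xs) len =
  trans (length-++ (f x)) (cong₂ _+_ (len (here refl)) (length-concatMap-const f xs (len ∘ there)))

length-arrangements : ∀ n k → k ≤ n → length (arrangements n k) * (n ∸ k) ! ≡ n !
length-arrangements n zero    _   = *-identityˡ (n !)
length-arrangements n (suc k) k<n = begin
  A (suc k) * (n ∸ suc k) !       ≡⟨ cong (_* (n ∸ suc k) !) (length-concatMap-const _ (arrangements n k) extensions) ⟩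
  A k * (n ∸ k) * (n ∸ suc k) !   ≡⟨ *-assoc (A k) (n ∸ k) _ ⟩
  A k * ((n ∸ k) * (n ∸ suc k) !) ≡⟨ cong (λ m → A k * (m * (n ∸ suc k) !)) n∸k≡1+n∸1+k ⟩
  A k * (suc (n ∸ suc k)) !       ≡⟨ cong (λ m → A k * m !) n∸k≡1+n∸1+k ⟨
  A k * (n ∸ k) !                 ≡⟨ length-arrangements n k (<⇒≤ k<n) ⟩
  n !                             ∎
  where
  open ≡-Reasoning
  A : ℕ → ℕ
  A j = length (arrangements n j)
  n∸k≡1+n∸1+k : n ∸ k ≡ suc (n ∸ suc k)
  n∸k≡1+n∸1+k = +-∸-assoc 1 k<n
  extensions : ∀ {w} → w ∈ arrangements n k → length (map (_∷ w) (complement n w)) ≡ n ∸ k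
  extensions {w} w∈ = trans (length-map (_∷ w) (complement n w)) (length-complement-injWord (arrangements-sound k w∈))

-- The matchings M⁺ and M⁻ of P₄ (facts checked by computation)

IsP4Arc : List ℕ × List ℕ → Set
IsP4Arc (a , b) = a ∈ arrangements 4 4 × b ∈ map (λ i → swapAt i a) (upTo 3)

isP4Arc? : ∀ e → Dec (IsP4Arc e)
isP4Arc? (a , b) = (a ∈ₗ? arrangements 4 4) ×-dec (b ∈ₗ? map (λ i → swapAt i a) (upTo 3))

sameEdge? : ∀ e f → Dec (SameEdge e f)
sameEdge? (a , b) (c , d) = ((a ≟ₗ c) ×-dec (b ≟ₗ d)) ⊎-dec ((a ≟ₗ d) ×-dec (b ≟ₗ c))

M±-arcs : ∀ p → All IsP4Arc (oriented (M± p))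
M±-arcs 0ℙ = from-yes (All.all? isP4Arc? (oriented Mplus))
M±-arcs 1ℙ = from-yes (All.all? isP4Arc? (oriented Mminus))

M±-matching : ∀ p → Unique (map proj₁ (oriented (M± p)))
M±-matching 0ℙ = from-yes (unique? (map proj₁ (oriented Mplus)))
M±-matching 1ℙ = from-yes (unique? (map proj₁ (oriented Mminus)))

M±-distinct : ∀ p → AllPairs (λ e f → ¬ SameEdge e f) (M± p)
M±-distinct 0ℙ = from-yes (allPairs? (λ e f → ¬? (sameEdge? e f)) Mplus)
M±-distinct 1ℙ = from-yes (allPairs? (λ e f → ¬? (sameEdge? e f)) Mminus)

MaximalAt : List (List ℕ × List ℕ) → List ℕ → Set
MaximalAt es π = All (λ i → Touches es π ⊎ Touches es (swapAt i π)) (upTo 3)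

maximalAt? : ∀ es π → Dec (MaximalAt es π)
maximalAt? es π = All.all? (λ i → touches? es π ⊎-dec touches? es (swapAt i π)) (upTo 3)

M±-maximal : ∀ p → All (MaximalAt (M± p)) (arrangements 4 4)
M±-maximal 0ℙ = from-yes (All.all? (maximalAt? Mplus) (arrangements 4 4))
M±-maximal 1ℙ = from-yes (All.all? (maximalAt? Mminus) (arrangements 4 4))

M⁺∪M⁻-covers : All (λ π → Touches Mplus π ⊎ Touches Mminus π) (arrangements 4 4)
M⁺∪M⁻-covers = from-yes (All.all? (λ π → touches? Mplus π ⊎-dec touches? Mminus π) (arrangements 4 4))

-- If the first five letters of u have pattern abcde, swapping positions 4 and 5 of u turns the
-- pattern of its first four letters from std(abcd) into std(abce), and changes ε by the parities
-- of d and e (sign-boundary).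
FivePattern : Parity → List ℕ → Set
FivePattern p (a ∷ b ∷ c ∷ d ∷ e ∷ []) =
  Touches (M± p) (standardise (a ∷ b ∷ c ∷ d ∷ [])) ⊎
  Touches (M± (p ℙ+ parity e ℙ+ parity d)) (standardise (a ∷ b ∷ c ∷ e ∷ []))
FivePattern p _ = ⊥

fivePattern? : ∀ p σ → Dec (FivePattern p σ)
fivePattern? p (a ∷ b ∷ c ∷ d ∷ e ∷ []) = touches? _ _ ⊎-dec touches? _ _
fivePattern? p []                        = no λ ()
fivePattern? p (_ ∷ [])                  = no λ ()
fivePattern? p (_ ∷ _ ∷ [])              = no λ ()
fivePattern? p (_ ∷ _ ∷ _ ∷ [])          = no λ ()
fivePattern? p (_ ∷ _ ∷ _ ∷ _ ∷ [])      = no λ ()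
fivePattern? p (_ ∷ _ ∷ _ ∷ _ ∷ _ ∷ _ ∷ _) = no λ ()

fivePatterns : ∀ p → All (FivePattern p) (arrangements 5 5)
fivePatterns 0ℙ = from-yes (All.all? (fivePattern? 0ℙ) (arrangements 5 5))
fivePatterns 1ℙ = from-yes (All.all? (fivePattern? 1ℙ) (arrangements 5 5))

-- M is a matching

data Arc (n : ℕ) : List ℕ → List ℕ → Set where
  arc : ∀ {s π ρ} → IsWordS n s → (π , ρ) ∈ oriented (M± (sign n s)) → Arc n (phi n s π) (phi n s ρ)

Medges⇒Arc : ∀ {n u v} → Medges n u v → Arc n u v
Medges⇒Arc {n} (inj₁ (s , w , _ , _ , _ , refl , e∈ , refl , refl)) =
  arc w (∈-oriented⁺ (inj₁ (subst (_ ∈_) (Meps≡M±-sign n s) e∈)))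
Medges⇒Arc {n} (inj₂ (s , w , _ , _ , _ , refl , e∈ , refl , refl)) =
  arc w (∈-oriented⁺ (inj₂ (subst (_ ∈_) (Meps≡M±-sign n s) e∈)))

Arc⇒Medges : ∀ {n u v} → Arc n u v → Medges n u v
Arc⇒Medges {n} (arc {s} {π} {ρ} w e) with ∈-oriented⁻ e
... | inj₁ πρ∈ = inj₁ (s , w , _ , π , ρ , refl , subst (_ ∈_) (sym (Meps≡M±-sign n s)) πρ∈ , refl , refl)
... | inj₂ ρπ∈ = inj₂ (s , w , _ , ρ , π , refl , subst (_ ∈_) (sym (Meps≡M±-sign n s)) ρπ∈ , refl , refl)

arc-endpoints : ∀ p {π ρ} → (π , ρ) ∈ oriented (M± p) → IsPerm 4 π × ∃ λ i → i < 3 × ρ ≡ swapAt i π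
arc-endpoints p {π} e with All.lookup (M±-arcs p) e
... | π∈ , ρ∈ with ∈-map⁻ (λ i → swapAt i π) ρ∈
... | i , i∈ , refl = injWord⇒perm (arrangements-sound 4 π∈) , i , ∈-upTo⁻ i∈ , refl

arc-source : ∀ p {π ρ} → (π , ρ) ∈ oriented (M± p) → IsPerm 4 π
arc-source p = proj₁ ∘ arc-endpoints p

Arc⇒PEdge : ∀ {n u v} → 4 ≤ n → Arc n u v → PEdge n u v
Arc⇒PEdge {n} 4≤n (arc {s} {π} w e) with arc-endpoints (sign n s) e
... | π↭ , i , i<3 , refl =
  phi-isPerm 4≤n w π↭ , phi-isPerm 4≤n w (↭-trans (swapAt-↭ i π) π↭) ,
  i , i<u , sym (phi-swapAt n s i (subst (suc i <_) (sym (length-perm π↭)) (s≤s i<3)))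
  where
  i<u : suc i < length (phi n s π)
  i<u = subst (suc i <_) (sym (length-perm (phi-isPerm 4≤n w π↭))) (<-≤-trans (s≤s i<3) 4≤n)

Arc-functional : ∀ {n u u′ v v′} → 4 ≤ n → Arc n u v → Arc n u′ v′ → u ≡ u′ → v ≡ v′
Arc-functional {n} 4≤n (arc {s} {π} w e) (arc {s′} {π′} w′ e′) eq
  with π↭ ← arc-source (sign n s) e | π′↭ ← arc-source (sign n s′) e′
  with refl ← phi-suffix n {s} {s′} {π} {π′} (trans (length-perm π↭) (sym (length-perm π′↭))) eq
  with refl ← phi-injective 4≤n w (perm-inRange π↭) (perm-inRange π′↭) eq
  = cong (phi n s) (Unique-proj₁⇒functional (M±-matching (sign n s)) e e′)

M-isMatching : ∀ {n} → 4 ≤ n → IsMatching n (Medges n)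
M-isMatching 4≤n = (λ _ _ → Arc⇒PEdge 4≤n ∘ Medges⇒Arc) ,
                   (λ _ _ _ uv uw → Arc-functional 4≤n (Medges⇒Arc uv) (Medges⇒Arc uw) refl)

-- M is maximal

Covered : ℕ → List ℕ → Set
Covered n u = ∃ λ w → Medges n u w

standardise∈arrangements : ∀ {xs} → Unique xs → standardise xs ∈ arrangements (length xs) (length xs)
standardise∈arrangements {xs} uxs =
  arrangements-complete (length-map (rank xs) xs , standardise-inRange xs , standardise-unique uxs)

standardise∈perms4 : ∀ {xs} → length xs ≡ 4 → Unique xs → standardise xs ∈ arrangements 4 4
standardise∈perms4 {xs} len uxs = subst (λ k → standardise xs ∈ arrangements k k) len (standardise∈arrangements uxs)

touches⇒covered : ∀ {n} xs {s} → length xs ≡ 4 → IsPerm n (xs ++ s) →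
  Touches (M± (sign n s)) (standardise xs) → Covered n (xs ++ s)
touches⇒covered {n} xs {s} len p t with touches⇒partner t
... | ρ , e = phi n s ρ ,
  subst (λ u → Medges n u (phi n s ρ)) (phi-standardise xs len p) (Arc⇒Medges (arc (proj₁ (perm-split xs len p)) e))

covered-swapHead : ∀ {n} xs {s} i → length xs ≡ 4 → i < 3 → IsPerm n (xs ++ s) → IsPerm n (swapAt i xs ++ s) →
  Covered n (xs ++ s) ⊎ Covered n (swapAt i xs ++ s)
covered-swapHead {n} xs {s} i len i<3 pu pv
  with All.lookup (All.lookup (M±-maximal (sign n s)) (standardise∈perms4 len (Unique-++⁻ˡ xs (perm-unique pu))))
                  (∈-upTo⁺ i<3)
... | inj₁ t = inj₁ (touches⇒covered xs len pu t)
... | inj₂ t = inj₂ (touches⇒covered (swapAt i xs) (trans (↭-length (swapAt-↭ i xs)) len) pv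
                       (subst (Touches _) (sym (standardise-swapAt i xs)) t))

touches-M±-or-flipped : ∀ p {π} → Touches Mplus π ⊎ Touches Mminus π →
  Touches (M± p) π ⊎ Touches (M± (p ⁻¹)) π
touches-M±-or-flipped 0ℙ t = t
touches-M±-or-flipped 1ℙ t = Sum.swap t

covered-swapTail : ∀ {n} xs {s} j → length xs ≡ 4 → suc j < length s →
  IsPerm n (xs ++ s) → IsPerm n (xs ++ swapAt j s) →
  Covered n (xs ++ s) ⊎ Covered n (xs ++ swapAt j s)
covered-swapTail {n} xs {s} j len j<s pu pv
  with touches-M±-or-flipped (sign n s)
         (All.lookup M⁺∪M⁻-covers (standardise∈perms4 len (Unique-++⁻ˡ xs (perm-unique pu))))
... | inj₁ t = inj₁ (touches⇒covered xs len pu t)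
... | inj₂ t = inj₂ (touches⇒covered xs len pv
                       (subst (λ p → Touches (M± p) (standardise xs))
                              (sym (sign-swapAt n j (Unique-++⁻ʳ xs (perm-unique pu)) j<s)) t))

boundary-touches : ∀ {n} x₁ x₂ x₃ x₄ y r →
  IsPerm n (x₁ ∷ x₂ ∷ x₃ ∷ x₄ ∷ y ∷ r) → IsPerm n (x₁ ∷ x₂ ∷ x₃ ∷ y ∷ x₄ ∷ r) →
  Touches (M± (sign n (y ∷ r))) (standardise (x₁ ∷ x₂ ∷ x₃ ∷ x₄ ∷ [])) ⊎
  Touches (M± (sign n (x₄ ∷ r))) (standardise (x₁ ∷ x₂ ∷ x₃ ∷ y ∷ []))
boundary-touches {n} x₁ x₂ x₃ x₄ y r pu pv =
  Sum.map (subst (Touches _) (standardise-map rank-mono xu⊆X))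
          (subst₂ Touches (cong M± (sym sign≡)) (standardise-map rank-mono xv⊆X))
          (All.lookup (fivePatterns (sign n (y ∷ r))) (standardise∈arrangements (Unique-++⁻ˡ X (perm-unique pu))))
  where
  X xu xv : List ℕ
  X = x₁ ∷ x₂ ∷ x₃ ∷ x₄ ∷ y ∷ []
  xu = x₁ ∷ x₂ ∷ x₃ ∷ x₄ ∷ []
  xv = x₁ ∷ x₂ ∷ x₃ ∷ y ∷ []
  x₄∈X : x₄ ∈ X
  x₄∈X = there (there (there (here refl)))
  y∈X : y ∈ X
  y∈X = there (there (there (there (here refl))))
  xu⊆X : All (_∈ X) xu
  xu⊆X = All.tabulate ∈-++⁺ˡ
  xv⊆X : All (_∈ X) xv
  xv⊆X = here refl ∷ there (here refl) ∷ there (there (here refl)) ∷ y∈X ∷ []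
  rank-mono : ∀ {a b} → a ∈ X → b ∈ X → a < b → rank X a < rank X b
  rank-mono a∈X _ = rank-strictMono a∈X
  sign≡ : sign n (x₄ ∷ r) ≡ sign n (y ∷ r) ℙ+ parity (rank X y) ℙ+ parity (rank X x₄)
  sign≡ with (_ , yr⊆[n] , uyr) , _ ← perm-split xu refl pu
            | (_ , x₄r⊆[n] , ux₄r) , _ ← perm-split xv refl pv
            = sign-boundary X pu x₄∈X y∈X x₄r⊆[n] ux₄r yr⊆[n] uyr

covered-swapBoundary : ∀ {n} x₁ x₂ x₃ x₄ y r →
  IsPerm n (x₁ ∷ x₂ ∷ x₃ ∷ x₄ ∷ y ∷ r) → IsPerm n (x₁ ∷ x₂ ∷ x₃ ∷ y ∷ x₄ ∷ r) →
  Covered n (x₁ ∷ x₂ ∷ x₃ ∷ x₄ ∷ y ∷ r) ⊎ Covered n (x₁ ∷ x₂ ∷ x₃ ∷ y ∷ x₄ ∷ r)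
covered-swapBoundary x₁ x₂ x₃ x₄ y r pu pv =
  Sum.map (touches⇒covered (x₁ ∷ x₂ ∷ x₃ ∷ x₄ ∷ []) refl pu)
          (touches⇒covered (x₁ ∷ x₂ ∷ x₃ ∷ y ∷ []) refl pv)
          (boundary-touches x₁ x₂ x₃ x₄ y r pu pv)

edge-covered : ∀ {n} u {v} → 4 ≤ length u → PEdge n u v → Covered n u ⊎ Covered n v
edge-covered (x₁ ∷ x₂ ∷ x₃ ∷ x₄ ∷ s) _ (pu , pv , 0 , _ , refl) =
  covered-swapHead (x₁ ∷ x₂ ∷ x₃ ∷ x₄ ∷ []) 0 refl (s≤s z≤n) pu pv
edge-covered (x₁ ∷ x₂ ∷ x₃ ∷ x₄ ∷ s) _ (pu , pv , 1 , _ , refl) =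
  covered-swapHead (x₁ ∷ x₂ ∷ x₃ ∷ x₄ ∷ []) 1 refl (s≤s (s≤s z≤n)) pu pv
edge-covered (x₁ ∷ x₂ ∷ x₃ ∷ x₄ ∷ s) _ (pu , pv , 2 , _ , refl) =
  covered-swapHead (x₁ ∷ x₂ ∷ x₃ ∷ x₄ ∷ []) 2 refl (s≤s (s≤s (s≤s z≤n))) pu pv
edge-covered (x₁ ∷ x₂ ∷ x₃ ∷ x₄ ∷ y ∷ r) _ (pu , pv , 3 , _ , refl) =
  covered-swapBoundary x₁ x₂ x₃ x₄ y r pu pv
edge-covered (x₁ ∷ x₂ ∷ x₃ ∷ x₄ ∷ []) _ (_ , _ , 3 , s≤s (s≤s (s≤s (s≤s ()))) , _)
edge-covered (x₁ ∷ x₂ ∷ x₃ ∷ x₄ ∷ s) _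
             (pu , pv , suc (suc (suc (suc j))) , s≤s (s≤s (s≤s (s≤s j<s))) , refl) =
  covered-swapTail (x₁ ∷ x₂ ∷ x₃ ∷ x₄ ∷ []) j refl j<s pu pv
edge-covered []                    ()
edge-covered (_ ∷ [])              (s≤s ())
edge-covered (_ ∷ _ ∷ [])          (s≤s (s≤s ()))
edge-covered (_ ∷ _ ∷ _ ∷ [])      (s≤s (s≤s (s≤s ())))

M-maximal : ∀ {n} → 4 ≤ n → ∀ u v → PEdge n u v → Covered n u ⊎ Covered n v
M-maximal 4≤n u v uv = edge-covered u (subst (4 ≤_) (sym (length-perm (proj₁ uv))) 4≤n) uv

-- Counting the edges of M

liftEdge : ℕ → List ℕ → List ℕ × List ℕ → List ℕ × List ℕ
liftEdge n s (a , b) = phi n s a , phi n s b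

liftedEdges : ℕ → List ℕ → List (List ℕ × List ℕ)
liftedEdges n s = map (liftEdge n s) (M± (sign n s))

edgeList : ℕ → List (List ℕ × List ℕ)
edgeList n = concatMap (liftedEdges n) (arrangements n (n ∸ 4))

edge-perms : ∀ p {a b} → (a , b) ∈ M± p → IsPerm 4 a × IsPerm 4 b
edge-perms p e = arc-source p (∈-oriented⁺ (inj₁ e)) , arc-source p (∈-oriented⁺ (inj₂ e))

edgeList-complete : ∀ {n u v} → Medges n u v → (u , v) ∈ edgeList n ⊎ (v , u) ∈ edgeList n
edgeList-complete {n} = Sum.map lift lift
  where
  lift : ∀ {u v} → InM n u v → (u , v) ∈ edgeList n
  lift (s , w , _ , _ , _ , refl , e∈ , refl , refl) = ∈-concatMap⁺ (liftedEdges n)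
    (lose (arrangements-complete w) (∈-map⁺ (liftEdge n s) (subst (_ ∈_) (Meps≡M±-sign n s) e∈)))

edgeList-sound : ∀ {n u v} → (u , v) ∈ edgeList n → Medges n u v
edgeList-sound {n} uv∈ with find (∈-concatMap⁻ (liftedEdges n) {xs = arrangements n (n ∸ 4)} uv∈)
... | s , s∈ , uv∈s with ∈-map⁻ (liftEdge n s) uv∈s
... | (a , b) , e∈ , refl =
  inj₁ (s , arrangements-sound (n ∸ 4) s∈ , (a , b) , a , b , refl ,
        subst (_ ∈_) (sym (Meps≡M±-sign n s)) e∈ , refl , refl)

liftEdge-injective : ∀ {n s} p → 4 ≤ n → IsWordS n s → ∀ {e f} → e ∈ M± p → f ∈ M± p →
  SameEdge (liftEdge n s e) (liftEdge n s f) → SameEdge e f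
liftEdge-injective {n} {s} p 4≤n w e∈ f∈ same with edge-perms p e∈ | edge-perms p f∈
... | a↭ , b↭ | c↭ , d↭ =
  Sum.map (Product.map (inj a↭ c↭) (inj b↭ d↭)) (Product.map (inj a↭ d↭) (inj b↭ c↭)) same
  where
  inj : ∀ {π ρ} → IsPerm 4 π → IsPerm 4 ρ → phi n s π ≡ phi n s ρ → π ≡ ρ
  inj π↭ ρ↭ = phi-injective 4≤n w (perm-inRange π↭) (perm-inRange ρ↭)

liftEdge-suffix : ∀ {n s t} p q {a b c d} → (a , b) ∈ M± p → (c , d) ∈ M± q →
  SameEdge (liftEdge n s (a , b)) (liftEdge n t (c , d)) → s ≡ t
liftEdge-suffix {n} {s} {t} p q {a} e∈ f∈ same with edge-perms p e∈ | edge-perms q f∈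
... | a↭ , _ | c↭ , d↭ = [ suffix c↭ ∘ proj₁ , suffix d↭ ∘ proj₁ ]′ same
  where
  suffix : ∀ {ρ} → IsPerm 4 ρ → phi n s a ≡ phi n t ρ → s ≡ t
  suffix {ρ} ρ↭ = phi-suffix n {s} {t} {a} {ρ} (trans (length-perm a↭) (sym (length-perm ρ↭)))

edgeList-distinct : ∀ {n} → 4 ≤ n → AllPairs (λ e f → ¬ SameEdge e f) (edgeList n)
edgeList-distinct {n} 4≤n = AllPairsP.concat⁺
  (AllP.map⁺ (All.tabulate (λ {s} s∈ → AllPairs-map⁺-on
    (λ e∈ f∈ e≉f → e≉f ∘ liftEdge-injective (sign n s) 4≤n (arrangements-sound (n ∸ 4) s∈) e∈ f∈)
    (All.tabulate (λ e∈ → e∈)) (M±-distinct (sign n s)))))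
  (AllPairsP.map⁺ (AllPairs.map different-blocks (arrangements-unique n (n ∸ 4))))
  where
  different-blocks : ∀ {s t} → s ≢ t →
    All (λ e → All (λ f → ¬ SameEdge e f) (liftedEdges n t)) (liftedEdges n s)
  different-blocks {s} {t} s≢t = AllP.map⁺ (All.tabulate (λ e∈ → AllP.map⁺ (All.tabulate (λ f∈ →
    s≢t ∘ liftEdge-suffix {n} {s} {t} (sign n s) (sign n t) e∈ f∈))))

length-M± : ∀ p → length (M± p) ≡ 8
length-M± 0ℙ = refl
length-M± 1ℙ = refl

length-edgeList : ∀ {n} → 4 ≤ n → length (edgeList n) ≡ n ! / 3
length-edgeList {n} 4≤n = begin
  length (edgeList n)          ≡⟨ length-concatMap-const (liftedEdges n) (arrangements n (n ∸ 4)) eight-each ⟩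
  A * 8                        ≡⟨ m*n/n≡m (A * 8) 3 ⟨
  A * 8 * 3 / 3                ≡⟨ cong (_/ 3) (*-assoc A 8 3) ⟩
  A * 4 ! / 3                  ≡⟨ cong (λ k → A * k ! / 3) (m∸[m∸n]≡n 4≤n) ⟨
  A * (n ∸ (n ∸ 4)) ! / 3      ≡⟨ cong (_/ 3) (length-arrangements n (n ∸ 4) (m∸n≤m n 4)) ⟩
  n ! / 3                      ∎
  where
  open ≡-Reasoning
  A : ℕ
  A = length (arrangements n (n ∸ 4))
  eight-each : ∀ {s} → s ∈ arrangements n (n ∸ 4) → length (liftedEdges n s) ≡ 8
  eight-each {s} _ = trans (length-map (liftEdge n s) (M± (sign n s))) (length-M± (sign n s))

edgeList-enumerates : ∀ {n} → 4 ≤ n → EnumeratesEdges (Medges n) (edgeList n)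
edgeList-enumerates 4≤n = (λ _ _ → edgeList-complete) , (λ _ _ → edgeList-sound) , edgeList-distinct 4≤n

theorem5p1 : (n : ℕ) → 4 ≤ n → IsMaximalMatching n (Medges n) × HasEdgeCount (Medges n) ((n !) / 3)
theorem5p1 n 4≤n = (M-isMatching 4≤n , M-maximal 4≤n) , edgeList n , edgeList-enumerates 4≤n , length-edgeList 4≤n
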